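{- Let $k$ be a nonnegative integer, let $\lambda$ be a complex number with $\lambda\neq1$, so that $Y_{0}^{(k)}(\lambda)=\frac{2^{k}}{(\lambda-1)^{k}}$, and let $n$ be a positive integer. Then \[ \sum_{j=0}^{k}(-1)^{k-j}(n)_{j}\binom{k}{j}\lambda^{2j}(1-\lambda)^{k-j}\,Y_{n-j}^{(k)}(\lambda)=0, \] where terms with $j>n$ are zero (since $(n)_j=0$ for $j>n$).
   Context: For a nonnegative integer $k$ and a complex number $\lambda\neq 1$, the numbers $Y_n^{(k)}(\lambda)$ are defined by the expansion (as formal power series in $t$) \[ \left(\frac{2}{\lambda(1+\lambda t)-1}\right)^{k}=\sum_{n=0}^{\infty}Y_{n}^{(k)}(\lambda)\frac{t^{n}}{n!}. \] $(x)_j=x(x-1)\cdots(x-j+1)$ denotes the falling factorial, with $(x)_0=1$. -}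

module Defs where

open import Algebra.Bundles using (CommutativeRing)
open import Data.Nat as ℕ using (ℕ; zero; suc; _∸_)
open import Data.Nat.Combinatorics using (_C_)
open import Data.List using (List; []; _∷_)

falling : ℕ → ℕ → ℕ
falling x zero = 1
falling x (suc j) = falling x j ℕ.* (x ∸ j)

factorial : ℕ → ℕ
factorial zero = 1
factorial (suc n) = suc n ℕ.* factorial n

module Series {c ℓ} (R : CommutativeRing c ℓ) where
  open CommutativeRing R

  -- formal power series = coefficient sequences
  PS : Set c
  PS = ℕ → Carrier

  sumTo : ℕ → (ℕ → Carrier) → Carrier
  sumTo zero f = f 0
  sumTo (suc n) f = sumTo n f + f (suc n)

  fromℕ : ℕ → Carrier
  fromℕ zero = 0#
  fromℕ (suc n) = 1# + fromℕ n

  pow : Carrier → ℕ → Carrier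
  pow x zero = 1#
  pow x (suc m) = x * pow x m

  one : PS
  one zero = 1#
  one (suc n) = 0#

  _⊛_ : PS → PS → PS
  (a ⊛ b) n = sumTo n (λ i → a i * b (n ∸ i))

  powPS : PS → ℕ → PS
  powPS a zero = one
  powPS a (suc m) = a ⊛ powPS a m

  scale : Carrier → PS → PS
  scale x a n = x * a n

  -- Inverse of a power series a whose constant term a 0 has inverse u:
  -- b_0 = u,  b_m = - u * Σ_{i=1}^{m} a_i b_{m-i}.
  module Inverse (a : PS) (u : Carrier) where
    -- go i [b_{m-1}, ..., b_0] with i = 1 computes Σ_{i=1}^{m} a_i b_{m-i}
    go : ℕ → List Carrier → Carrier
    go i [] = 0#
    go i (b ∷ bs) = a i * b + go (suc i) bs

    -- coeffs m = [b_m, b_{m-1}, ..., b_0]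
    coeffs : ℕ → List Carrier
    coeffs zero = u ∷ []
    coeffs (suc m) = (- (u * go 1 (coeffs m))) ∷ coeffs m

    headOr0 : List Carrier → Carrier
    headOr0 [] = 0#
    headOr0 (b ∷ _) = b

    inv : PS
    inv m = headOr0 (coeffs m)

  inverse : PS → Carrier → PS
  inverse a u = Inverse.inv a u

  two : Carrier
  two = 1# + 1#

  -- the denominator λ(1+λt) - 1 = (λ - 1) + λ² t as a power series in t
  denom : Carrier → PS
  denom lam zero = lam * 1# - 1#
  denom lam (suc zero) = lam * lam
  denom lam (suc (suc _)) = 0#

  -- 2 / (λ(1+λt) - 1), given an inverse u of the constant term λ - 1
  gen : Carrier → Carrier → PS
  gen lam u = scale two (inverse (denom lam) u)

  -- Y_n^{(k)}(λ) = n! * [t^n] (2/(λ(1+λt)-1))^k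
  Y : ℕ → Carrier → Carrier → ℕ → Carrier
  Y k lam u n = fromℕ (factorial n) * powPS (gen lam u) k n

  term : ℕ → ℕ → Carrier → Carrier → ℕ → Carrier
  term k n lam u j =
    pow (- 1#) (k ∸ j) * fromℕ (falling n j) * fromℕ (k C j)
      * pow lam (2 ℕ.* j) * pow (1# - lam) (k ∸ j) * Y k lam u (n ∸ j)

-- Write d = λ - 1 and e = λ², so that the generating function of the
-- Y^{(k)} is G^k with G = 2 / (d + e t).  Since (d + e t) G = 2, we get
-- (d + e t)^k G^k = 2^k, whose coefficient of t^n vanishes for n ≥ 1.
-- Expanding (d + e t)^k by the binomial theorem, that coefficient is
--   Σ_j C(k,j) e^j d^(k-j) [t^(n-j)] G^k,
-- and multiplying by n! = (n)_j (n-j)! turns it into the sum of the theorem,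
-- because (-1)^(k-j) (1-λ)^(k-j) = d^(k-j).
--
-- To avoid developing associativity of the Cauchy product, multiplication by
-- d + e t is handled as an operator L on coefficient sequences.

module Submission where

open import Defs
open import Algebra.Bundles using (CommutativeRing)
open import Data.Nat using (ℕ; _≤_)
open import Data.Nat as N using (zero; suc; _∸_; _<_; s≤s)
import Data.Nat.Properties as NP
open import Data.Nat.Combinatorics using (_C_; nCk+nC[k+1]≡[n+1]C[k+1]; k>n⇒nCk≡0)
open import Data.List using ([]; _∷_)
open import Relation.Binary.PropositionalEquality as P using (_≡_)
open import Relation.Nullary using (yes; no)

∸-pred : ∀ {j n} → j < n → n ∸ j ≡ suc (n ∸ suc j)
∸-pred {n = suc m} (s≤s j≤m) = NP.+-∸-assoc 1 j≤m

factorial-step : ∀ {j n} → j < n → (n ∸ j) N.* factorial (n ∸ suc j) ≡ factorial (n ∸ j)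
factorial-step j<n rewrite ∸-pred j<n = P.refl

falling*factorial : ∀ n j → j ≤ n → falling n j N.* factorial (n ∸ j) ≡ factorial n
falling*factorial n zero _ = NP.*-identityˡ (factorial n)
falling*factorial n (suc j) j<n = begin
  falling n j N.* (n ∸ j) N.* factorial (n ∸ suc j)    ≡⟨ NP.*-assoc (falling n j) _ _ ⟩
  falling n j N.* ((n ∸ j) N.* factorial (n ∸ suc j))  ≡⟨ P.cong (falling n j N.*_) (factorial-step j<n) ⟩
  falling n j N.* factorial (n ∸ j)                    ≡⟨ falling*factorial n j (NP.<⇒≤ j<n) ⟩
  factorial n                                          ∎
  where open P.≡-Reasoning

falling-vanishes : ∀ {n j} → n < j → falling n j ≡ 0
falling-vanishes {n} {suc j} (s≤s n≤j) =
  P.trans (P.cong (falling n j N.*_) (NP.m≤n⇒m∸n≡0 n≤j)) (NP.*-zeroʳ (falling n j))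

module Development {c ℓ} (R : CommutativeRing c ℓ) where
  open CommutativeRing R
  open Series R
  open import Relation.Binary.Reasoning.Setoid setoid
  open import Algebra.Solver.Ring.NaturalCoefficients.Default commutativeSemiring
    using (solve; _:=_; _:+_; _:*_; con)
  open import Algebra.Properties.Ring ring using (-1*x≈-x; -‿distribʳ-*)
  open import Algebra.Properties.AbelianGroup +-abelianGroup using (⁻¹-anti-homo‿-)
  open import Algebra.Properties.CommutativeSemigroup *-commutativeSemigroup using (x∙yz≈y∙xz)

  sumTo-cong : ∀ n {f g : ℕ → Carrier} → (∀ i → f i ≈ g i) → sumTo n f ≈ sumTo n g
  sumTo-cong zero f≈g = f≈g 0
  sumTo-cong (suc n) f≈g = +-cong (sumTo-cong n f≈g) (f≈g (suc n))

  sumTo-lincomb : ∀ n x y (f g : ℕ → Carrier) →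
    sumTo n (λ i → x * f i + y * g i) ≈ x * sumTo n f + y * sumTo n g
  sumTo-lincomb zero x y f g = refl
  sumTo-lincomb (suc n) x y f g = trans (+-cong (sumTo-lincomb n x y f g) refl)
    (solve 6 (λ x y F G f g → (x :* F :+ y :* G) :+ (x :* f :+ y :* g) := x :* (F :+ f) :+ y :* (G :+ g))
      refl x y (sumTo n f) (sumTo n g) (f (suc n)) (g (suc n)))

  sumTo-*ˡ : ∀ n x (f : ℕ → Carrier) → sumTo n (λ i → x * f i) ≈ x * sumTo n f
  sumTo-*ˡ zero x f = refl
  sumTo-*ˡ (suc n) x f = trans (+-cong (sumTo-*ˡ n x f) refl) (sym (distribˡ x _ _))

  sumTo-zero : ∀ n (f : ℕ → Carrier) → (∀ i → f i ≈ 0#) → sumTo n f ≈ 0#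
  sumTo-zero zero f f≈0 = f≈0 0
  sumTo-zero (suc n) f f≈0 = trans (+-cong (sumTo-zero n f f≈0) (f≈0 (suc n))) (+-identityˡ 0#)

  sumTo-peel : ∀ n (f : ℕ → Carrier) → sumTo (suc n) f ≈ f 0 + sumTo n (λ i → f (suc i))
  sumTo-peel zero f = refl
  sumTo-peel (suc n) f = trans (+-cong (sumTo-peel n f) refl) (+-assoc _ _ _)

  fromℕ-+ : ∀ m n → fromℕ (m N.+ n) ≈ fromℕ m + fromℕ n
  fromℕ-+ zero n = sym (+-identityˡ _)
  fromℕ-+ (suc m) n = trans (+-cong refl (fromℕ-+ m n)) (sym (+-assoc _ _ _))

  fromℕ-* : ∀ m n → fromℕ (m N.* n) ≈ fromℕ m * fromℕ n
  fromℕ-* zero n = sym (zeroˡ _)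
  fromℕ-* (suc m) n = begin
    fromℕ (n N.+ m N.* n)          ≈⟨ fromℕ-+ n (m N.* n) ⟩
    fromℕ n + fromℕ (m N.* n)      ≈⟨ +-cong (sym (*-identityˡ _)) (fromℕ-* m n) ⟩
    1# * fromℕ n + fromℕ m * fromℕ n  ≈⟨ distribʳ _ _ _ ⟨
    (1# + fromℕ m) * fromℕ n       ∎

  pow-cong : ∀ {x y} m → x ≈ y → pow x m ≈ pow y m
  pow-cong zero x≈y = refl
  pow-cong (suc m) x≈y = *-cong x≈y (pow-cong m x≈y)

  pow-distrib : ∀ x y m → pow x m * pow y m ≈ pow (x * y) m
  pow-distrib x y zero = *-identityˡ 1#
  pow-distrib x y (suc m) =
    trans (solve 4 (λ x y p q → (x :* p) :* (y :* q) := (x :* y) :* (p :* q)) refl x y (pow x m) (pow y m))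
          (*-cong refl (pow-distrib x y m))

  pow-double : ∀ x j → pow x (2 N.* j) ≈ pow (x * x) j
  pow-double x zero = refl
  pow-double x (suc j) = trans (reflexive (P.cong (pow x) (NP.*-suc 2 j)))
    (trans (sym (*-assoc x x _)) (*-cong refl (pow-double x j)))

  -- Shifts of coefficient sequences: sh is multiplication by t, shiftBy j by t^j.

  sh : PS → PS
  sh a zero = 0#
  sh a (suc n) = a n

  shiftBy : ℕ → PS → PS
  shiftBy zero a = a
  shiftBy (suc j) a = sh (shiftBy j a)

  shiftBy-within : ∀ j n a → j ≤ n → shiftBy j a n ≡ a (n ∸ j)
  shiftBy-within zero n a _ = P.refl
  shiftBy-within (suc j) (suc n) a (s≤s j≤n) = shiftBy-within j n a j≤n

  shiftBy-beyond : ∀ j n a → n < j → shiftBy j a n ≡ 0#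
  shiftBy-beyond (suc j) zero a _ = P.refl
  shiftBy-beyond (suc j) (suc n) a (s≤s n<j) = shiftBy-beyond j n a n<j

  sh-cong : ∀ {a b : PS} → (∀ m → a m ≈ b m) → ∀ m → sh a m ≈ sh b m
  sh-cong a≈b zero = refl
  sh-cong a≈b (suc m) = a≈b m

  one-vanishes : ∀ {n} → 1 ≤ n → one n ≡ 0#
  one-vanishes (s≤s _) = P.refl

  one-⊛ : ∀ x (b : PS) n → (scale x one ⊛ b) n ≈ x * b n
  one-⊛ x b zero = *-cong (*-identityʳ x) refl
  one-⊛ x b (suc m) = trans (sumTo-peel m _)
    (trans (+-cong (*-cong (*-identityʳ x) refl)
                   (sumTo-zero m _ (λ i → trans (*-cong (zeroʳ x) refl) (zeroˡ _))))
           (+-identityʳ _))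

  ⊛-congˡ : ∀ {a a' : PS} → (∀ i → a i ≈ a' i) → ∀ b n → (a ⊛ b) n ≈ (a' ⊛ b) n
  ⊛-congˡ a≈a' b n = sumTo-cong n (λ i → *-cong (a≈a' i) refl)

  falling-shift : ∀ n j (b : PS) →
    fromℕ (falling n j) * (fromℕ (factorial (n ∸ j)) * b (n ∸ j)) ≈ fromℕ (factorial n) * shiftBy j b n
  falling-shift n j b with j N.≤? n
  ... | yes j≤n = begin
    fromℕ (falling n j) * (fromℕ (factorial (n ∸ j)) * b (n ∸ j))
      ≈⟨ *-assoc _ _ _ ⟨
    fromℕ (falling n j) * fromℕ (factorial (n ∸ j)) * b (n ∸ j)
      ≈⟨ *-cong (sym (fromℕ-* (falling n j) _)) refl ⟩
    fromℕ (falling n j N.* factorial (n ∸ j)) * b (n ∸ j)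
      ≈⟨ *-cong (reflexive (P.cong fromℕ (falling*factorial n j j≤n))) (reflexive (P.sym (shiftBy-within j n b j≤n))) ⟩
    fromℕ (factorial n) * shiftBy j b n ∎
  ... | no j≰n = begin
    fromℕ (falling n j) * (fromℕ (factorial (n ∸ j)) * b (n ∸ j))
      ≈⟨ *-cong (reflexive (P.cong fromℕ (falling-vanishes (NP.≰⇒> j≰n)))) refl ⟩
    0# * (fromℕ (factorial (n ∸ j)) * b (n ∸ j))  ≈⟨ zeroˡ _ ⟩
    0#                                              ≈⟨ zeroʳ _ ⟨
    fromℕ (factorial n) * 0#
      ≈⟨ *-cong refl (reflexive (P.sym (shiftBy-beyond j n b (NP.≰⇒> j≰n)))) ⟩
    fromℕ (factorial n) * shiftBy j b n ∎

  module LinearFactor (d e : Carrier) where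

    L : PS → PS
    L a n = d * a n + e * sh a n

    L-cong : ∀ {a b : PS} → (∀ m → a m ≈ b m) → ∀ m → L a m ≈ L b m
    L-cong a≈b m = +-cong (*-cong refl (a≈b m)) (*-cong refl (sh-cong a≈b m))

    L-scale : ∀ x a m → L (scale x a) m ≈ x * L a m
    L-scale x a zero =
      solve 4 (λ x d e a → d :* (x :* a) :+ e :* con 0 := x :* (d :* a :+ e :* con 0)) refl x d e (a 0)
    L-scale x a (suc m) =
      solve 5 (λ x d e a b → d :* (x :* a) :+ e :* (x :* b) := x :* (d :* a :+ e :* b)) refl x d e (a (suc m)) (a m)

    L-conv : ∀ a b n → L (a ⊛ b) n ≈ (L a ⊛ b) n
    L-conv a b zero =
      solve 4 (λ d e x y → d :* (x :* y) :+ e :* con 0 := (d :* x :+ e :* con 0) :* y) refl d e (a 0) (b 0)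
    L-conv a b (suc m) = begin
      d * conv (suc m) + e * conv m
        ≈⟨ +-cong (*-cong refl (sumTo-peel m _)) refl ⟩
      d * (a 0 * b (suc m) + tail) + e * conv m
        ≈⟨ solve 6 (λ d e x y t s → d :* (x :* y :+ t) :+ e :* s := (d :* x :+ e :* con 0) :* y :+ (d :* t :+ e :* s))
             refl d e (a 0) (b (suc m)) tail (conv m) ⟩
      L a 0 * b (suc m) + (d * tail + e * conv m)
        ≈⟨ +-cong refl (sumTo-lincomb m d e _ _) ⟨
      L a 0 * b (suc m) + sumTo m (λ i → d * (a (suc i) * b (m ∸ i)) + e * (a i * b (m ∸ i)))
        ≈⟨ +-cong refl (sumTo-cong m (λ i →
             solve 5 (λ d e x y z → d :* (x :* z) :+ e :* (y :* z) := (d :* x :+ e :* y) :* z)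
               refl d e (a (suc i)) (a i) (b (m ∸ i)))) ⟩
      L a 0 * b (suc m) + sumTo m (λ i → L a (suc i) * b (m ∸ i))
        ≈⟨ sumTo-peel m _ ⟨
      (L a ⊛ b) (suc m) ∎
      where
      conv : ℕ → Carrier
      conv n = (a ⊛ b) n
      tail : Carrier
      tail = sumTo m (λ i → a (suc i) * b (m ∸ i))

    Lpow : ℕ → PS → PS
    Lpow zero a = a
    Lpow (suc k) a = Lpow k (L a)

    Lpow-unfold : ∀ k a → Lpow (suc k) a ≡ L (Lpow k a)
    Lpow-unfold zero a = P.refl
    Lpow-unfold (suc k) a = Lpow-unfold k (L a)

    Lpow-cong : ∀ k {a b : PS} → (∀ m → a m ≈ b m) → ∀ m → Lpow k a m ≈ Lpow k b m
    Lpow-cong zero a≈b = a≈b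
    Lpow-cong (suc k) a≈b = Lpow-cong k (L-cong a≈b)

    Lpow-scale : ∀ k x a m → Lpow k (scale x a) m ≈ x * Lpow k a m
    Lpow-scale zero x a m = refl
    Lpow-scale (suc k) x a m = trans (Lpow-cong k (L-scale x a) m) (Lpow-scale k x (L a) m)

    annihilate : ∀ (G : PS) x → (∀ n → L G n ≈ scale x one n) → ∀ k n → Lpow k (powPS G k) n ≈ pow x k * one n
    annihilate G x LG≈x zero n = sym (*-identityˡ (one n))
    annihilate G x LG≈x (suc k) n = begin
      Lpow k (L (G ⊛ powPS G k)) n    ≈⟨ Lpow-cong k step n ⟩
      Lpow k (scale x (powPS G k)) n  ≈⟨ Lpow-scale k x (powPS G k) n ⟩
      x * Lpow k (powPS G k) n        ≈⟨ *-cong refl (annihilate G x LG≈x k n) ⟩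
      x * (pow x k * one n)           ≈⟨ *-assoc _ _ _ ⟨
      pow x (suc k) * one n           ∎
      where
      step : ∀ m → L (G ⊛ powPS G k) m ≈ x * powPS G k m
      step m = trans (L-conv G (powPS G k) m)
                     (trans (⊛-congˡ LG≈x (powPS G k) m) (one-⊛ x (powPS G k) m))

    -- Binomial expansion of L^k: the weight of t^j in (d + e t)^k is C(k,j) e^j d^(k-j).
    weight : ℕ → ℕ → Carrier
    weight k j = fromℕ (k C j) * pow e j * pow d (k ∸ j)

    binomialSum : ℕ → (ℕ → Carrier) → Carrier
    binomialSum k g = sumTo k (λ j → weight k j * g j)

    weight-beyond : ∀ k → weight k (suc k) ≈ 0#
    weight-beyond k rewrite k>n⇒nCk≡0 (NP.n<1+n k) = trans (*-cong (zeroˡ _) refl) (zeroˡ _)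

    -- Inside the weight C(k, j+1) one may write d^(k-j) = d · d^(k-j-1); when
    -- j + 1 > k this holds because the binomial coefficient vanishes.
    binomial-absorb : ∀ k j x →
      fromℕ (k C suc j) * x * pow d (k ∸ j) ≈ d * (fromℕ (k C suc j) * x * pow d (k ∸ suc j))
    binomial-absorb k j x with suc j N.≤? k
    ... | yes j<k = trans (*-cong refl (reflexive (P.cong (pow d) (∸-pred j<k))))
      (solve 4 (λ c x d p → c :* x :* (d :* p) := d :* (c :* x :* p)) refl (fromℕ (k C suc j)) x d (pow d (k ∸ suc j)))
    ... | no j≮k rewrite k>n⇒nCk≡0 (NP.≰⇒> j≮k) =
      solve 4 (λ x p d q → con 0 :* x :* p := d :* (con 0 :* x :* q)) refl x (pow d (k ∸ j)) d (pow d (k ∸ suc j))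

    weight-pascal : ∀ k j → weight (suc k) (suc j) ≈ e * weight k j + d * weight k (suc j)
    weight-pascal k j = begin
      fromℕ (suc k C suc j) * (e * pow e j) * pow d (k ∸ j)
        ≈⟨ *-cong (*-cong (reflexive (P.cong fromℕ (P.sym (nCk+nC[k+1]≡[n+1]C[k+1] k j)))) refl) refl ⟩
      fromℕ (k C j N.+ k C suc j) * (e * pow e j) * pow d (k ∸ j)
        ≈⟨ *-cong (*-cong (fromℕ-+ (k C j) (k C suc j)) refl) refl ⟩
      (fromℕ (k C j) + fromℕ (k C suc j)) * (e * pow e j) * pow d (k ∸ j)
        ≈⟨ solve 5 (λ a b e E D → (a :+ b) :* (e :* E) :* D := e :* (a :* E :* D) :+ b :* (e :* E) :* D)
             refl (fromℕ (k C j)) (fromℕ (k C suc j)) e (pow e j) (pow d (k ∸ j)) ⟩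
      e * weight k j + fromℕ (k C suc j) * (e * pow e j) * pow d (k ∸ j)
        ≈⟨ +-cong refl (binomial-absorb k j (e * pow e j)) ⟩
      e * weight k j + d * weight k (suc j) ∎

    -- Multiplying a binomial sum by d + e t raises its order by one.
    pascal : ∀ k (g : ℕ → Carrier) →
      binomialSum (suc k) g ≈ d * binomialSum k g + e * binomialSum k (λ j → g (suc j))
    pascal k g = begin
      binomialSum (suc k) g
        ≈⟨ sumTo-peel k _ ⟩
      weight (suc k) 0 * g 0 + sumTo k (λ j → weight (suc k) (suc j) * g (suc j))
        ≈⟨ +-cong refl (sumTo-cong k (λ j → trans (*-cong (weight-pascal k j) refl)
             (solve 5 (λ e d w v g → (e :* w :+ d :* v) :* g := e :* (w :* g) :+ d :* (v :* g))
               refl e d (weight k j) (weight k (suc j)) (g (suc j))))) ⟩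
      weight (suc k) 0 * g 0 + sumTo k (λ j → e * (weight k j * g (suc j)) + d * (weight k (suc j) * g (suc j)))
        ≈⟨ +-cong refl (sumTo-lincomb k e d _ _) ⟩
      weight (suc k) 0 * g 0 + (e * shifted + d * rest)
        ≈⟨ solve 8 (λ c o d p g e s r → c :* o :* (d :* p) :* g :+ (e :* s :+ d :* r) := d :* (c :* o :* p :* g :+ r) :+ e :* s)
             refl (fromℕ 1) 1# d (pow d k) (g 0) e shifted rest ⟩
      d * (weight k 0 * g 0 + rest) + e * shifted
        ≈⟨ +-cong (*-cong refl (sumTo-peel k _)) refl ⟨
      d * sumTo (suc k) (λ j → weight k j * g j) + e * shifted
        ≈⟨ +-cong (*-cong refl dropLast) refl ⟩
      d * binomialSum k g + e * shifted ∎
      where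
      shifted : Carrier
      shifted = binomialSum k (λ j → g (suc j))
      rest : Carrier
      rest = sumTo k (λ j → weight k (suc j) * g (suc j))
      dropLast : sumTo (suc k) (λ j → weight k j * g j) ≈ binomialSum k g
      dropLast = trans (+-cong refl (trans (*-cong (weight-beyond k) refl) (zeroˡ _))) (+-identityʳ _)

    expansion : ∀ k a n → Lpow k a n ≈ binomialSum k (λ j → shiftBy j a n)
    expansion zero a n = sym (trans (*-cong weight00 refl) (*-identityˡ _))
      where
      weight00 : weight 0 0 ≈ 1#
      weight00 = trans (*-identityʳ _) (trans (*-identityʳ _) (+-identityʳ 1#))
    expansion (suc k) a n = begin
      Lpow (suc k) a n
        ≡⟨ P.cong-app (Lpow-unfold k a) n ⟩
      d * Lpow k a n + e * sh (Lpow k a) n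
        ≈⟨ +-cong (*-cong refl (expansion k a n)) (*-cong refl (shifted-expansion n)) ⟩
      d * binomialSum k (λ j → shiftBy j a n) + e * binomialSum k (λ j → shiftBy (suc j) a n)
        ≈⟨ pascal k _ ⟨
      binomialSum (suc k) (λ j → shiftBy j a n) ∎
      where
      shifted-expansion : ∀ m → sh (Lpow k a) m ≈ binomialSum k (λ j → shiftBy (suc j) a m)
      shifted-expansion zero = sym (sumTo-zero k _ (λ j → zeroʳ _))
      shifted-expansion (suc m) = expansion k a m

  module LinearInverse (a : PS) (u : Carrier) (a₀u≈1 : a 0 * u ≈ 1#)
                       (linear : ∀ m → a (suc (suc m)) ≈ 0#) where
    open LinearFactor (a 0) (a 1)
    open Inverse a u

    higher-vanish : ∀ i bs → go (suc (suc i)) bs ≈ 0#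
    higher-vanish i [] = refl
    higher-vanish i (b ∷ bs) =
      trans (+-cong (trans (*-cong (linear i) refl) (zeroˡ b)) (higher-vanish (suc i) bs)) (+-identityˡ 0#)

    go-linear : ∀ m → go 1 (coeffs m) ≈ a 1 * inv m
    go-linear zero = +-identityʳ _
    go-linear (suc m) = trans (+-cong refl (higher-vanish 0 (coeffs m))) (+-identityʳ _)

    inverse-linear : ∀ n → L inv n ≈ one n
    inverse-linear zero = trans (+-cong a₀u≈1 (zeroʳ _)) (+-identityʳ _)
    inverse-linear (suc m) = begin
      a 0 * (- (u * go 1 (coeffs m))) + a 1 * inv m  ≈⟨ +-cong (-‿distribʳ-* (a 0) _) refl ⟨
      - (a 0 * (u * go 1 (coeffs m))) + a 1 * inv m  ≈⟨ +-cong (-‿cong (*-assoc _ _ _)) refl ⟨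
      - (a 0 * u * go 1 (coeffs m)) + a 1 * inv m    ≈⟨ +-cong (-‿cong (*-cong a₀u≈1 (go-linear m))) refl ⟩
      - (1# * (a 1 * inv m)) + a 1 * inv m           ≈⟨ +-cong (-‿cong (*-identityˡ _)) refl ⟩
      - (a 1 * inv m) + a 1 * inv m                  ≈⟨ -‿inverseˡ _ ⟩
      0#                                             ∎

  module GeneratingFunction (lam u : Carrier) (hyp : (lam - 1#) * u ≈ 1#) where
    open LinearFactor (denom lam 0) (denom lam 1)

    L-gen : ∀ n → L (gen lam u) n ≈ scale two one n
    L-gen n = trans (L-scale two (inverse (denom lam) u) n)
      (*-cong refl (LinearInverse.inverse-linear (denom lam) u d·u≈1 (λ _ → refl) n))
      where
      d·u≈1 : denom lam 0 * u ≈ 1#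
      d·u≈1 = trans (*-cong (+-cong (*-identityʳ lam) refl) refl) hyp

    sign : ∀ m → pow (- 1#) m * pow (1# - lam) m ≈ pow (denom lam 0) m
    sign m = trans (pow-distrib (- 1#) (1# - lam) m) (pow-cong m negate)
      where
      negate : - 1# * (1# - lam) ≈ denom lam 0
      negate = trans (-1*x≈-x _) (trans (⁻¹-anti-homo‿- 1# lam) (+-cong (sym (*-identityʳ lam)) refl))

    term-weighted : ∀ k n j →
      term k n lam u j ≈ fromℕ (factorial n) * (weight k j * shiftBy j (powPS (gen lam u) k) n)
    term-weighted k n j = begin
      A * B * Cc * E2 * D' * (F * X)
        ≈⟨ solve 7 (λ A B C E D F X → A :* B :* C :* E :* D :* (F :* X) := C :* E :* (A :* D) :* (B :* (F :* X)))
             refl A B Cc E2 D' F X ⟩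
      Cc * E2 * (A * D') * (B * (F * X))
        ≈⟨ *-cong (*-cong (*-cong refl (pow-double lam j)) (sign (k ∸ j))) (falling-shift n j Gk) ⟩
      weight k j * (fromℕ (factorial n) * shiftBy j Gk n)
        ≈⟨ x∙yz≈y∙xz _ _ _ ⟩
      fromℕ (factorial n) * (weight k j * shiftBy j Gk n) ∎
      where
      Gk : PS
      Gk = powPS (gen lam u) k
      A B Cc E2 D' F X : Carrier
      A = pow (- 1#) (k ∸ j)
      B = fromℕ (falling n j)
      Cc = fromℕ (k C j)
      E2 = pow lam (2 N.* j)
      D' = pow (1# - lam) (k ∸ j)
      F = fromℕ (factorial (n ∸ j))
      X = Gk (n ∸ j)

mainTheorem3 : ∀ {c ℓ} (R : CommutativeRing c ℓ) →
    let open CommutativeRing R in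
    let open Series R in
    (lam u : Carrier) → (lam - 1#) * u ≈ 1# →
    (k n : ℕ) → 1 ≤ n →
    sumTo k (term k n lam u) ≈ 0#
mainTheorem3 R lam u hyp k n 1≤n = begin
  sumTo k (term k n lam u)                           ≈⟨ sumTo-cong k (term-weighted k n) ⟩
  sumTo k (λ j → N! * (weight k j * shiftBy j Gk n))  ≈⟨ sumTo-*ˡ k N! _ ⟩
  N! * binomialSum k (λ j → shiftBy j Gk n)          ≈⟨ *-cong refl (expansion k Gk n) ⟨
  N! * Lpow k Gk n                                   ≈⟨ *-cong refl (annihilate (gen lam u) two L-gen k n) ⟩
  N! * (pow two k * one n)                           ≈⟨ *-cong refl (*-cong refl (reflexive (one-vanishes 1≤n))) ⟩
  N! * (pow two k * 0#)                              ≈⟨ trans (*-cong refl (zeroʳ _)) (zeroʳ _) ⟩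
  0#                                                 ∎
  where
  open CommutativeRing R
  open Series R
  open Development R
  open LinearFactor (denom lam 0) (denom lam 1)
  open GeneratingFunction lam u hyp
  open import Relation.Binary.Reasoning.Setoid setoid
  N! : Carrier
  N! = fromℕ (factorial n)
  Gk : PS
  Gk = powPS (gen lam u) k
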